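{- Let $\ell\geq 0$ and $S=S_{1,1,\ell}$ (for $\ell=0$ this is $S_{1,1}=P_3$). Then in the game $\mathbf{0.33}$, $\mathcal{G}(S)=|V(S)| \bmod 3=\ell \bmod 3$.
   Context: The game $\mathbf{0.33}$ on a finite graph $G$: players alternate; a move chooses a set $X$ of one vertex or of two adjacent vertices of $G$, lying in a connected component $H$ of $G$, such that $H-X$ is empty or connected, and deletes $X$. A player unable to move loses (normal play). Grundy value: $\mathcal{G}(G)=\mathrm{mex}\{\mathcal{G}(G'): G' \text{ reachable in one move}\}$. Subdivided star $S_{\ell_1,\ldots,\ell_k}$: a central vertex $c$ with $k$ vertex-disjoint paths of $\ell_1,\ldots,\ell_k$ vertices each having one endpoint adjacent to $c$; a path with $0$ vertices means no path. -}

module Defs where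

open import Data.Nat using (ℕ; zero; suc; _+_; _≤_; _<_)
open import Data.Fin using (Fin; toℕ)
open import Data.Fin.Subset using (Subset; _∈_; _∉_; ⁅_⁆; _∪_; _∩_; ∁; _⊆_)
open import Data.Product using (Σ; _×_; _,_)
open import Data.Sum using (_⊎_)
open import Relation.Binary.PropositionalEquality using (_≡_; _≢_)

-- A finite graph on vertex set Fin n is given by its adjacency relation.
-- Positions of the game are vertex subsets P (the induced subgraph G[P]).

data Reach {n : ℕ} (Adj : Fin n → Fin n → Set) (P : Subset n) : Fin n → Fin n → Set where
  here : ∀ {u} → u ∈ P → Reach Adj P u u
  step : ∀ {u w v} → Reach Adj P u w → Adj w v → v ∈ P → Reach Adj P u v

data SmallSet {n : ℕ} (Adj : Fin n → Fin n → Set) : Subset n → Set where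
  one : (x : Fin n) → SmallSet Adj ⁅ x ⁆
  two : (x y : Fin n) → Adj x y → SmallSet Adj (⁅ x ⁆ ∪ ⁅ y ⁆)

-- A move of 0.33 from position P to P': delete a legal set X lying in a connected
-- component H of G[P] (H = component of a chosen vertex x ∈ X), such that H - X
-- is empty or connected.
Move : {n : ℕ} (Adj : Fin n → Fin n → Set) → Subset n → Subset n → Set
Move {n} Adj P P' =
  Σ (Subset n) λ X → Σ (Fin n) λ x →
    SmallSet Adj X × x ∈ X ×
    (∀ y → y ∈ X → Reach Adj P x y) ×                          -- X ⊆ H
    (∀ u v → Reach Adj P x u → Reach Adj P x v → u ∉ X → v ∉ X →
       Reach Adj (P ∩ ∁ X) u v) ×                               -- H - X empty or connected
    P' ≡ P ∩ ∁ X

data IsGrundy {n : ℕ} (Adj : Fin n → Fin n → Set) : Subset n → ℕ → Set where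
  mex : ∀ {P g} →
        (∀ P' → Move Adj P P' → Σ ℕ λ g' → IsGrundy Adj P' g' × g' ≢ g) →
        (∀ k → k < g → Σ (Subset n) λ P' → Move Adj P P' × IsGrundy Adj P' k) →
        IsGrundy Adj P g

-- Subdivided star S_{1,1,ℓ} on vertex set Fin (3 + ℓ):
-- 0 = centre c, 1 and 2 = the two leaves, 3,4,...,ℓ+2 = the path of ℓ vertices
-- (vertex 3 adjacent to c, consecutive path vertices adjacent).
StarEdge : (ℓ : ℕ) → Fin (3 + ℓ) → Fin (3 + ℓ) → Set
StarEdge ℓ u v =
  (toℕ u ≡ 0 × toℕ v ≡ 1) ⊎ (toℕ u ≡ 0 × toℕ v ≡ 2) ⊎ (toℕ u ≡ 0 × toℕ v ≡ 3) ⊎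
  (3 ≤ toℕ u × toℕ v ≡ suc (toℕ u))

StarAdj : (ℓ : ℕ) → Fin (3 + ℓ) → Fin (3 + ℓ) → Set
StarAdj ℓ u v = StarEdge ℓ u v ⊎ StarEdge ℓ v u

module Submission where

open import Defs
open import Data.Nat using (ℕ; zero; suc; _%_; _+_; _≤_; _<_; z≤n; s≤s; s≤s⁻¹)
open import Data.Nat.Properties using (≤-refl; ≤-trans; <-≤-trans; n≤1+n; <-irrefl; <⇒≤; ≤∧≢⇒<; suc-injective; 1+n≢0)
  renaming (_≟_ to _≟ℕ_)
open import Data.Nat.Induction using (<-wellFounded)
open import Data.Fin using (Fin; toℕ; fromℕ<) renaming (zero to fzero; suc to fsuc)
open import Data.Fin.Properties using (toℕ-injective; toℕ<n; toℕ-fromℕ<) renaming (_≟_ to _≟F_)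
open import Data.Fin.Subset
  using (Subset; ⊤; ⊥; ∣_∣; _∈_; _∉_; _⊆_; ⁅_⁆; _∪_; _∩_; ∁; Nonempty; inside; outside)
open import Data.Fin.Subset.Properties
  using (∈⊤; ∣⊤∣≡n; ∣⊥∣≡0; nonempty?; Empty-unique; ∩-identityʳ; ∩-assoc; ∪-∩-booleanAlgebra;
         x∈⁅x⁆; x∈⁅y⁆⇒x≡y; x∈p∩q⁺; x∈p∩q⁻; x∉p⇒x∈∁p; x∈∁p⇒x∉p; x≢y⇒x∉⁅y⁆;
         p⊆p∪q; q⊆p∪q; x∈p∪q⁻)
import Algebra.Lattice.Properties.BooleanAlgebra as BooleanAlgebraProperties
open import Data.Vec.Base using ([]; _∷_; here; there)
open import Data.Product using (Σ; _×_; _,_; proj₁; proj₂)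
open import Data.Sum using (_⊎_; inj₁; inj₂)
open import Data.Empty using (⊥-elim)
open import Induction.WellFounded as WF using ()
import Relation.Binary.Construct.On as On
open import Relation.Nullary using (¬_; yes; no; contradiction)
open import Relation.Binary.PropositionalEquality

-- Every move of 0.33 from a connected position deletes one or two vertices and leaves a connected
-- position, so its options have sizes |P| - 1 and |P| - 2, whose residues mod 3 differ from that of |P|.
-- If moreover every nonempty connected position has a leaf, and every connected position of size 2 mod 3
-- has an edge that can be peeled off leaf by leaf, then these deletions realise every smaller residue,
-- and induction on |P| gives G(P) = |P| mod 3 for every connected P.  In S_{1,1,ℓ} rooted at its centre
-- the vertex with the largest label is a leaf, and its parent becomes a leaf once it is deleted, except
-- when P is the claw K_{1,3}, whose size 4 is not 2 mod 3.

n%3≢[1+n]%3 : ∀ n → n % 3 ≢ suc n % 3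
n%3≢[1+n]%3 0 ()
n%3≢[1+n]%3 1 ()
n%3≢[1+n]%3 2 ()
n%3≢[1+n]%3 (suc (suc (suc n))) = n%3≢[1+n]%3 n

n%3≢[2+n]%3 : ∀ n → n % 3 ≢ suc (suc n) % 3
n%3≢[2+n]%3 0 ()
n%3≢[2+n]%3 1 ()
n%3≢[2+n]%3 2 ()
n%3≢[2+n]%3 (suc (suc (suc n))) = n%3≢[2+n]%3 n

[1+n]%3≡1+k⇒n%3≡k : ∀ n {k} → suc n % 3 ≡ suc k → n % 3 ≡ k
[1+n]%3≡1+k⇒n%3≡k 0 refl = refl
[1+n]%3≡1+k⇒n%3≡k 1 refl = refl
[1+n]%3≡1+k⇒n%3≡k 2 ()
[1+n]%3≡1+k⇒n%3≡k (suc (suc (suc n))) = [1+n]%3≡1+k⇒n%3≡k n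

[2+n]%3≡2⇒n%3≡0 : ∀ n → suc (suc n) % 3 ≡ 2 → n % 3 ≡ 0
[2+n]%3≡2⇒n%3≡0 0 refl = refl
[2+n]%3≡2⇒n%3≡0 1 ()
[2+n]%3≡2⇒n%3≡0 2 ()
[2+n]%3≡2⇒n%3≡0 (suc (suc (suc n))) = [2+n]%3≡2⇒n%3≡0 n

n%3≡2⇒n≢0 : ∀ {n} → n % 3 ≡ 2 → n ≢ 0
n%3≡2⇒n≢0 {zero} ()
n%3≡2⇒n≢0 {suc n} _ ()

n%3≡2⇒n≢1 : ∀ {n} → n % 3 ≡ 2 → n ≢ 1
n%3≡2⇒n≢1 {1} ()
n%3≡2⇒n≢1 {zero} _ ()
n%3≡2⇒n≢1 {suc (suc n)} _ ()

k<n%3⇒1+k≡n%3⊎n%3≡2 : ∀ n {k} → k < n % 3 → suc k ≡ n % 3 ⊎ (k ≡ 0 × n % 3 ≡ 2)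
k<n%3⇒1+k≡n%3⊎n%3≡2 0 ()
k<n%3⇒1+k≡n%3⊎n%3≡2 1 {0} _ = inj₁ refl
k<n%3⇒1+k≡n%3⊎n%3≡2 1 {suc _} (s≤s ())
k<n%3⇒1+k≡n%3⊎n%3≡2 2 {0} _ = inj₂ (refl , refl)
k<n%3⇒1+k≡n%3⊎n%3≡2 2 {1} _ = inj₁ refl
k<n%3⇒1+k≡n%3⊎n%3≡2 2 {suc (suc _)} (s≤s (s≤s ()))
k<n%3⇒1+k≡n%3⊎n%3≡2 (suc (suc (suc n))) = k<n%3⇒1+k≡n%3⊎n%3≡2 n

private
  variable
    n : ℕ
    p : Subset n
    x y : Fin n

infixl 5 _∖_

_∖_ : Subset n → Fin n → Subset n
p ∖ x = p ∩ ∁ ⁅ x ⁆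

p∖x⊆p : p ∖ x ⊆ p
p∖x⊆p {p = p} y∈ = proj₁ (x∈p∩q⁻ p _ y∈)

x∈p∖y⇒x≢y : x ∈ p ∖ y → x ≢ y
x∈p∖y⇒x≢y {p = p} {y = y} x∈ refl = x∈∁p⇒x∉p (proj₂ (x∈p∩q⁻ p _ x∈)) (x∈⁅x⁆ y)

x∈p∧x≢y⇒x∈p∖y : x ∈ p → x ≢ y → x ∈ p ∖ y
x∈p∧x≢y⇒x∈p∖y x∈p x≢y = x∈p∩q⁺ (x∈p , x∉p⇒x∈∁p (x≢y⇒x∉⁅y⁆ x≢y))

p∖x∖y≡p∩∁⁅x⁆∪⁅y⁆ : ∀ (p : Subset n) x y → p ∖ x ∖ y ≡ p ∩ ∁ (⁅ x ⁆ ∪ ⁅ y ⁆)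
p∖x∖y≡p∩∁⁅x⁆∪⁅y⁆ p x y = begin
  (p ∩ ∁ ⁅ x ⁆) ∩ ∁ ⁅ y ⁆   ≡⟨ ∩-assoc p _ _ ⟩
  p ∩ (∁ ⁅ x ⁆ ∩ ∁ ⁅ y ⁆)   ≡⟨ cong (p ∩_) (sym (deMorgan₂ ⁅ x ⁆ ⁅ y ⁆)) ⟩
  p ∩ ∁ (⁅ x ⁆ ∪ ⁅ y ⁆)     ∎
  where open ≡-Reasoning
        open BooleanAlgebraProperties (∪-∩-booleanAlgebra _) using (deMorgan₂)

∣p∣≡1+∣p∖x∣ : x ∈ p → ∣ p ∣ ≡ suc ∣ p ∖ x ∣
∣p∣≡1+∣p∖x∣ {p = inside ∷ p} here = cong suc (cong ∣_∣ (sym p∩∁⊥≡p))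
  where
  open BooleanAlgebraProperties (∪-∩-booleanAlgebra _) using (¬⊥≈⊤)
  p∩∁⊥≡p : p ∩ ∁ ⊥ ≡ p
  p∩∁⊥≡p = trans (cong (p ∩_) ¬⊥≈⊤) (∩-identityʳ p)
∣p∣≡1+∣p∖x∣ {p = inside ∷ p} (there x∈p) = cong suc (∣p∣≡1+∣p∖x∣ x∈p)
∣p∣≡1+∣p∖x∣ {p = outside ∷ p} (there x∈p) = ∣p∣≡1+∣p∖x∣ x∈p

∣p∣≡2+∣p∖x∖y∣ : x ∈ p → y ∈ p → x ≢ y → ∣ p ∣ ≡ suc (suc ∣ p ∖ x ∖ y ∣)
∣p∣≡2+∣p∖x∖y∣ x∈p y∈p x≢y =
  trans (∣p∣≡1+∣p∖x∣ x∈p) (cong suc (∣p∣≡1+∣p∖x∣ (x∈p∧x≢y⇒x∈p∖y y∈p (≢-sym x≢y))))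

∣p∣≢0⇒nonempty : ∀ {n} (p : Subset n) → ∣ p ∣ ≢ 0 → Nonempty p
∣p∣≢0⇒nonempty {n} p ∣p∣≢0 with nonempty? p
... | yes nonempty = nonempty
... | no empty = ⊥-elim (∣p∣≢0 (trans (cong ∣_∣ (Empty-unique empty)) (∣⊥∣≡0 n)))

other-member : ∀ {p : Subset n} {x} → x ∈ p → ∣ p ∣ ≢ 1 → Σ (Fin n) λ y → y ∈ p × y ≢ x
other-member {p = p} {x = x} x∈p ∣p∣≢1
  with ∣p∣≢0⇒nonempty (p ∖ x) (λ ∣p∖x∣≡0 → ∣p∣≢1 (trans (∣p∣≡1+∣p∖x∣ x∈p) (cong suc ∣p∖x∣≡0)))
... | y , y∈p∖x = y , p∖x⊆p y∈p∖x , x∈p∖y⇒x≢y y∈p∖x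

UpperBound : Subset n → Fin n → Set
UpperBound p m = ∀ {x} → x ∈ p → toℕ x ≤ toℕ m

max-member : ∀ (p : Subset n) → Nonempty p → Σ (Fin n) λ m → m ∈ p × UpperBound p m
max-member (s ∷ p) nonempty with nonempty? p
... | yes nonempty-p with max-member p nonempty-p
...   | m , m∈p , max = fsuc m , there m∈p , λ { {fzero} _ → z≤n ; {fsuc x} (there x∈p) → s≤s (max x∈p) }
max-member (s ∷ p) (fzero , 0∈) | no empty =
  fzero , 0∈ , λ { {fzero} _ → z≤n ; {fsuc x} (there x∈p) → ⊥-elim (empty (x , x∈p)) }
max-member (s ∷ p) (fsuc x , there x∈p) | no empty = ⊥-elim (empty (x , x∈p))

∣p∣≡k-by-labels : ∀ (p : Subset n) k → (∀ {x} → x ∈ p → toℕ x < k) →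
                  (∀ {i} → i < k → Σ (Fin n) λ x → x ∈ p × toℕ x ≡ i) → ∣ p ∣ ≡ k
∣p∣≡k-by-labels [] zero _ _ = refl
∣p∣≡k-by-labels [] (suc k) _ onto with onto {0} (s≤s z≤n)
... | () , _
∣p∣≡k-by-labels (inside ∷ p) zero below _ with below here
... | ()
∣p∣≡k-by-labels (outside ∷ p) zero below _ = ∣p∣≡k-by-labels p zero (λ x∈p → <⇒≤ (below (there x∈p))) (λ ())
∣p∣≡k-by-labels (outside ∷ p) (suc k) _ onto with onto {0} (s≤s z≤n)
... | fzero , () , _
... | fsuc _ , _ , ()
∣p∣≡k-by-labels (inside ∷ p) (suc k) below onto =
  cong suc (∣p∣≡k-by-labels p k (λ x∈p → s≤s⁻¹ (below (there x∈p))) onto-p)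
  where
  onto-p : ∀ {i} → i < k → Σ _ λ x → x ∈ p × toℕ x ≡ i
  onto-p i<k with onto (s≤s i<k)
  ... | fzero , _ , ()
  ... | fsuc x , there x∈p , 1+x≡1+i = x , x∈p , suc-injective 1+x≡1+i

module Graph {n : ℕ} (Adj : Fin n → Fin n → Set) where

  reach-source : ∀ {P u v} → Reach Adj P u v → u ∈ P
  reach-source (here u∈P) = u∈P
  reach-source (step r _ _) = reach-source r

  reach-target : ∀ {P u v} → Reach Adj P u v → v ∈ P
  reach-target (here v∈P) = v∈P
  reach-target (step _ _ v∈P) = v∈P

  reach-trans : ∀ {P u v w} → Reach Adj P u v → Reach Adj P v w → Reach Adj P u w
  reach-trans r (here _) = r
  reach-trans r (step s a w∈P) = step (reach-trans r s) a w∈P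

  reach-last-edge : ∀ {P u v} → Reach Adj P u v → u ≢ v → Σ (Fin n) λ w → w ∈ P × Adj w v
  reach-last-edge (here _) u≢u = ⊥-elim (u≢u refl)
  reach-last-edge (step r a _) _ = _ , reach-target r , a

  Connected : Subset n → Set
  Connected P = ∀ {u v} → u ∈ P → v ∈ P → Reach Adj P u v

  -- m has at most one neighbour in P (m itself need not lie in P).
  Leaf : Subset n → Fin n → Set
  Leaf P m = ∀ {w w′} → w ∈ P → w′ ∈ P → Adj w m → Adj w′ m → w ≡ w′

  -- {leaf, stem} can be deleted in one move, leaving a connected position.
  record PendantEdge (P : Subset n) : Set where
    field
      leaf stem   : Fin n
      leaf∈P      : leaf ∈ P
      stem∈P      : stem ∈ P
      edge        : Adj leaf stem
      leaf-is-leaf : Leaf P leaf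
      stem-is-leaf : Leaf (P ∖ leaf) stem

module Game {n : ℕ} (Adj : Fin n → Fin n → Set)
            (adj-sym : ∀ {x y} → Adj x y → Adj y x) (adj-irrefl : ∀ {x} → ¬ Adj x x) where

  open Graph Adj

  adjacent⇒distinct : ∀ {x y} → Adj x y → x ≢ y
  adjacent⇒distinct x~y refl = adj-irrefl x~y

  reach-sym : ∀ {P u v} → Reach Adj P u v → Reach Adj P v u
  reach-sym (here u∈P) = here u∈P
  reach-sym (step r a v∈P) = reach-trans (step (here v∈P) (adj-sym a) (reach-target r)) (reach-sym r)

  -- A walk can enter and leave the leaf m only through its unique neighbour, so visits to m can be cut out.
  leaf-bypass : ∀ {P m u w} → Leaf P m → u ≢ m → Reach Adj P u w →
                (w ≢ m → Reach Adj (P ∖ m) u w) ×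
                (w ≡ m → ∀ {z} → z ∈ P → Adj z m → Reach Adj (P ∖ m) u z)
  leaf-bypass _ u≢m (here u∈P) = (λ _ → here (x∈p∧x≢y⇒x∈p∖y u∈P u≢m)) , (λ u≡m → ⊥-elim (u≢m u≡m))
  leaf-bypass {P} {m} {u} leaf u≢m (step {w = w} {v = v} r w~v v∈P) = avoiding-v , around-v
    where
    ih = leaf-bypass leaf u≢m r

    avoiding-v : v ≢ m → Reach Adj (P ∖ m) u v
    avoiding-v v≢m with w ≟F m
    ... | yes refl = proj₂ ih refl v∈P (adj-sym w~v)
    ... | no w≢m = step (proj₁ ih w≢m) w~v (x∈p∧x≢y⇒x∈p∖y v∈P v≢m)

    around-v : v ≡ m → ∀ {z} → z ∈ P → Adj z m → Reach Adj (P ∖ m) u z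
    around-v refl z∈P z~m =
      subst (Reach Adj (P ∖ m) u) (leaf (reach-target r) z∈P w~v z~m)
            (proj₁ ih (adjacent⇒distinct w~v))

  leaf-removal-connected : ∀ {P m} → Leaf P m → Connected P → Connected (P ∖ m)
  leaf-removal-connected leaf connected u∈ v∈ =
    proj₁ (leaf-bypass leaf (x∈p∖y⇒x≢y u∈) (connected (p∖x⊆p u∈) (p∖x⊆p v∈))) (x∈p∖y⇒x≢y v∈)

  connected-move : ∀ {P X x} → Connected P → SmallSet Adj X → x ∈ X → X ⊆ P →
                   Connected (P ∩ ∁ X) → Move Adj P (P ∩ ∁ X)
  connected-move {P} {X} {x} connected small x∈X X⊆P connected′ =
    X , x , small , x∈X , (λ _ y∈X → connected (X⊆P x∈X) (X⊆P y∈X)) ,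
    (λ _ _ x⇝u x⇝v u∉X v∉X → connected′ (outside-X x⇝u u∉X) (outside-X x⇝v v∉X)) , refl
    where
    outside-X : ∀ {u} → Reach Adj P x u → u ∉ X → u ∈ P ∩ ∁ X
    outside-X x⇝u u∉X = x∈p∩q⁺ (reach-target x⇝u , x∉p⇒x∈∁p u∉X)

  leaf-move : ∀ {P m} → Connected P → m ∈ P → Leaf P m → Move Adj P (P ∖ m)
  leaf-move {m = m} connected m∈P leaf =
    connected-move connected (one m) (x∈⁅x⁆ m)
      (λ y∈⁅m⁆ → subst (_∈ _) (sym (x∈⁅y⁆⇒x≡y m y∈⁅m⁆)) m∈P)
      (leaf-removal-connected leaf connected)

  pendant-edge-move : ∀ {P} → Connected P → (e : PendantEdge P) →
                      Move Adj P (P ∖ PendantEdge.leaf e ∖ PendantEdge.stem e)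
  pendant-edge-move {P} connected e =
    subst (Move Adj P) (sym (p∖x∖y≡p∩∁⁅x⁆∪⁅y⁆ P leaf stem))
      (connected-move connected (two leaf stem edge) (p⊆p∪q ⁅ stem ⁆ (x∈⁅x⁆ leaf)) X⊆P
        (subst Connected (p∖x∖y≡p∩∁⁅x⁆∪⁅y⁆ P leaf stem)
          (leaf-removal-connected stem-is-leaf (leaf-removal-connected leaf-is-leaf connected))))
    where
    open PendantEdge e
    X⊆P : ⁅ leaf ⁆ ∪ ⁅ stem ⁆ ⊆ P
    X⊆P y∈X with x∈p∪q⁻ ⁅ leaf ⁆ ⁅ stem ⁆ y∈X
    ... | inj₁ y∈⁅leaf⁆ = subst (_∈ P) (sym (x∈⁅y⁆⇒x≡y leaf y∈⁅leaf⁆)) leaf∈P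
    ... | inj₂ y∈⁅stem⁆ = subst (_∈ P) (sym (x∈⁅y⁆⇒x≡y stem y∈⁅stem⁆)) stem∈P

  move-connected : ∀ {P P′} → Connected P → Move Adj P P′ → Connected P′
  move-connected {P} connected (X , x , _ , x∈X , X⊆H , H∖X-connected , refl) u∈ v∈ =
    H∖X-connected _ _ (connected x∈P (proj₁ u∈P∩∁X)) (connected x∈P (proj₁ v∈P∩∁X))
                      (x∈∁p⇒x∉p (proj₂ u∈P∩∁X)) (x∈∁p⇒x∉p (proj₂ v∈P∩∁X))
    where
    x∈P = reach-source (X⊆H x x∈X)
    u∈P∩∁X = x∈p∩q⁻ P (∁ X) u∈
    v∈P∩∁X = x∈p∩q⁻ P (∁ X) v∈

  move-size : ∀ {P P′} → Move Adj P P′ → ∣ P ∣ ≡ suc ∣ P′ ∣ ⊎ ∣ P ∣ ≡ suc (suc ∣ P′ ∣)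
  move-size (_ , _ , one y , _ , X⊆H , _ , refl) = inj₁ (∣p∣≡1+∣p∖x∣ (reach-target (X⊆H y (x∈⁅x⁆ y))))
  move-size {P} (_ , _ , two y z y~z , _ , X⊆H , _ , refl) =
    inj₂ (subst (λ Q → ∣ P ∣ ≡ suc (suc ∣ Q ∣)) (p∖x∖y≡p∩∁⁅x⁆∪⁅y⁆ P y z)
           (∣p∣≡2+∣p∖x∖y∣ (reach-target (X⊆H y (p⊆p∪q ⁅ z ⁆ (x∈⁅x⁆ y))))
                          (reach-target (X⊆H z (q⊆p∪q ⁅ y ⁆ ⁅ z ⁆ (x∈⁅x⁆ z))))
                          (adjacent⇒distinct y~z)))

  move-shrinks : ∀ {P P′} → Move Adj P P′ → ∣ P′ ∣ < ∣ P ∣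
  move-shrinks move with move-size move
  ... | inj₁ ∣P∣≡1+∣P′∣ = subst (_ <_) (sym ∣P∣≡1+∣P′∣) ≤-refl
  ... | inj₂ ∣P∣≡2+∣P′∣ = subst (_ <_) (sym ∣P∣≡2+∣P′∣) (n≤1+n _)

  move-changes-size%3 : ∀ {P P′} → Move Adj P P′ → ∣ P′ ∣ % 3 ≢ ∣ P ∣ % 3
  move-changes-size%3 {P} {P′} move with move-size move
  ... | inj₁ ∣P∣≡1+∣P′∣ = subst (λ s → ∣ P′ ∣ % 3 ≢ s % 3) (sym ∣P∣≡1+∣P′∣) (n%3≢[1+n]%3 ∣ P′ ∣)
  ... | inj₂ ∣P∣≡2+∣P′∣ = subst (λ s → ∣ P′ ∣ % 3 ≢ s % 3) (sym ∣P∣≡2+∣P′∣) (n%3≢[2+n]%3 ∣ P′ ∣)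

  module _ (leaf-exists : ∀ {P} → Connected P → Nonempty P → Σ (Fin n) λ m → m ∈ P × Leaf P m)
           (pendant-edge-exists : ∀ {P} → Connected P → ∣ P ∣ % 3 ≡ 2 → PendantEdge P) where

    grundy≡size%3 : ∀ P → Connected P → IsGrundy Adj P (∣ P ∣ % 3)
    grundy≡size%3 = All.wfRec (λ P → Connected P → IsGrundy Adj P (∣ P ∣ % 3)) grundy-step
      where
      module All = WF.All (On.wellFounded ∣_∣ <-wellFounded) _

      grundy-step : ∀ P → (∀ {P′} → ∣ P′ ∣ < ∣ P ∣ → Connected P′ → IsGrundy Adj P′ (∣ P′ ∣ % 3)) →
                    Connected P → IsGrundy Adj P (∣ P ∣ % 3)
      grundy-step P ih connected = mex excluded realised
        where
        option : ∀ {P′} → Move Adj P P′ → IsGrundy Adj P′ (∣ P′ ∣ % 3)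
        option move = ih (move-shrinks move) (move-connected connected move)

        excluded : ∀ P′ → Move Adj P P′ → Σ ℕ λ g → IsGrundy Adj P′ g × g ≢ ∣ P ∣ % 3
        excluded _ move = _ , option move , move-changes-size%3 move

        delete-leaf : ∀ {k} → suc k ≡ ∣ P ∣ % 3 → Σ (Subset n) λ P′ → Move Adj P P′ × IsGrundy Adj P′ k
        delete-leaf {k} 1+k≡∣P∣%3
          with leaf-exists connected (∣p∣≢0⇒nonempty P (λ ∣P∣≡0 → 1+n≢0 (trans 1+k≡∣P∣%3 (cong (_% 3) ∣P∣≡0))))
        ... | m , m∈P , leaf = P ∖ m , move , subst (IsGrundy Adj (P ∖ m)) ∣P∖m∣%3≡k (option move)
          where
          move = leaf-move connected m∈P leaf
          ∣P∖m∣%3≡k : ∣ P ∖ m ∣ % 3 ≡ k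
          ∣P∖m∣%3≡k = [1+n]%3≡1+k⇒n%3≡k ∣ P ∖ m ∣ (trans (cong (_% 3) (sym (∣p∣≡1+∣p∖x∣ m∈P))) (sym 1+k≡∣P∣%3))

        delete-pendant-edge : ∣ P ∣ % 3 ≡ 2 → Σ (Subset n) λ P′ → Move Adj P P′ × IsGrundy Adj P′ 0
        delete-pendant-edge ∣P∣%3≡2 = _ , move , subst (IsGrundy Adj _) ∣P′∣%3≡0 (option move)
          where
          e = pendant-edge-exists connected ∣P∣%3≡2
          open PendantEdge e
          move = pendant-edge-move connected e
          ∣P′∣%3≡0 : ∣ P ∖ leaf ∖ stem ∣ % 3 ≡ 0
          ∣P′∣%3≡0 = [2+n]%3≡2⇒n%3≡0 ∣ P ∖ leaf ∖ stem ∣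
            (trans (cong (_% 3) (sym (∣p∣≡2+∣p∖x∖y∣ leaf∈P stem∈P (adjacent⇒distinct edge)))) ∣P∣%3≡2)

        realised : ∀ k → k < ∣ P ∣ % 3 → Σ (Subset n) λ P′ → Move Adj P P′ × IsGrundy Adj P′ k
        realised k k<∣P∣%3 with k<n%3⇒1+k≡n%3⊎n%3≡2 ∣ P ∣ k<∣P∣%3
        ... | inj₁ 1+k≡∣P∣%3 = delete-leaf 1+k≡∣P∣%3
        ... | inj₂ (refl , ∣P∣%3≡2) = delete-pendant-edge ∣P∣%3≡2

infix 4 _⋖_

-- Rooting S_{1,1,ℓ} at its centre, a ⋖ b says that the vertex labelled a is the parent of the vertex
-- labelled b; StarEdge ℓ u v is exactly toℕ u ⋖ toℕ v.
data _⋖_ : ℕ → ℕ → Set where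
  0⋖1   : 0 ⋖ 1
  0⋖2   : 0 ⋖ 2
  0⋖3   : 0 ⋖ 3
  k⋖1+k : ∀ {k} → 3 ≤ k → k ⋖ suc k

⋖⇒< : ∀ {a b} → a ⋖ b → a < b
⋖⇒< 0⋖1 = s≤s z≤n
⋖⇒< 0⋖2 = s≤s z≤n
⋖⇒< 0⋖3 = s≤s z≤n
⋖⇒< (k⋖1+k _) = ≤-refl

⋖-parent : ∀ {b} → b ≢ 0 → Σ ℕ (_⋖ b)
⋖-parent {0} 0≢0 = ⊥-elim (0≢0 refl)
⋖-parent {1} _ = 0 , 0⋖1
⋖-parent {2} _ = 0 , 0⋖2
⋖-parent {3} _ = 0 , 0⋖3
⋖-parent {suc (suc (suc (suc k)))} _ = 3 + k , k⋖1+k (s≤s (s≤s (s≤s z≤n)))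

⋖-parent-unique : ∀ {a b c} → a ⋖ c → b ⋖ c → a ≡ b
⋖-parent-unique 0⋖1 0⋖1 = refl
⋖-parent-unique 0⋖2 0⋖2 = refl
⋖-parent-unique 0⋖3 0⋖3 = refl
⋖-parent-unique 0⋖2 (k⋖1+k (s≤s ()))
⋖-parent-unique 0⋖3 (k⋖1+k (s≤s (s≤s ())))
⋖-parent-unique (k⋖1+k (s≤s (s≤s ()))) 0⋖3
⋖-parent-unique (k⋖1+k _) (k⋖1+k _) = refl

⋖-child-unique : ∀ {a b c} → a ⋖ b → a ⋖ c → a ≢ 0 → b ≡ c
⋖-child-unique (k⋖1+k _) (k⋖1+k _) _ = refl
⋖-child-unique 0⋖1 _ 0≢0 = ⊥-elim (0≢0 refl)
⋖-child-unique 0⋖2 _ 0≢0 = ⊥-elim (0≢0 refl)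
⋖-child-unique 0⋖3 _ 0≢0 = ⊥-elim (0≢0 refl)

centre-claw : ∀ {a b c} → 0 ⋖ a → 0 ⋖ b → 0 ⋖ c → a < c → b < c → a ≢ b →
              c ≡ 3 × (∀ {i} → i < 4 → i ≡ 0 ⊎ i ≡ a ⊎ i ≡ b ⊎ i ≡ c)
centre-claw 0⋖1 0⋖2 0⋖3 _ _ _ = refl , λ
  { {0} _ → inj₁ refl ; {1} _ → inj₂ (inj₁ refl) ; {2} _ → inj₂ (inj₂ (inj₁ refl))
  ; {3} _ → inj₂ (inj₂ (inj₂ refl)) ; {suc (suc (suc (suc _)))} (s≤s (s≤s (s≤s (s≤s ())))) }
centre-claw 0⋖2 0⋖1 0⋖3 _ _ _ = refl , λ
  { {0} _ → inj₁ refl ; {1} _ → inj₂ (inj₂ (inj₁ refl)) ; {2} _ → inj₂ (inj₁ refl)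
  ; {3} _ → inj₂ (inj₂ (inj₂ refl)) ; {suc (suc (suc (suc _)))} (s≤s (s≤s (s≤s (s≤s ())))) }
centre-claw 0⋖1 0⋖1 _ _ _ 1≢1 = ⊥-elim (1≢1 refl)
centre-claw 0⋖2 0⋖2 _ _ _ 2≢2 = ⊥-elim (2≢2 refl)
centre-claw 0⋖1 _ 0⋖1 (s≤s ()) _ _
centre-claw 0⋖2 _ 0⋖1 (s≤s ()) _ _
centre-claw 0⋖3 _ 0⋖1 (s≤s ()) _ _
centre-claw 0⋖2 _ 0⋖2 (s≤s (s≤s ())) _ _
centre-claw 0⋖3 _ 0⋖2 (s≤s (s≤s ())) _ _
centre-claw 0⋖3 _ 0⋖3 (s≤s (s≤s (s≤s ()))) _ _
centre-claw _ 0⋖2 0⋖2 _ (s≤s (s≤s ())) _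
centre-claw _ 0⋖3 0⋖1 _ (s≤s ()) _
centre-claw _ 0⋖3 0⋖2 _ (s≤s (s≤s ())) _
centre-claw _ 0⋖3 0⋖3 _ (s≤s (s≤s (s≤s ()))) _

module Star (ℓ : ℕ) where

  Vertex : Set
  Vertex = Fin (3 + ℓ)

  centre : Vertex
  centre = fzero

  edge⇒⋖ : ∀ {u v} → StarEdge ℓ u v → toℕ u ⋖ toℕ v
  edge⇒⋖ (inj₁ (u≡0 , v≡1)) rewrite u≡0 | v≡1 = 0⋖1
  edge⇒⋖ (inj₂ (inj₁ (u≡0 , v≡2))) rewrite u≡0 | v≡2 = 0⋖2
  edge⇒⋖ (inj₂ (inj₂ (inj₁ (u≡0 , v≡3)))) rewrite u≡0 | v≡3 = 0⋖3
  edge⇒⋖ (inj₂ (inj₂ (inj₂ (3≤u , v≡1+u)))) rewrite v≡1+u = k⋖1+k 3≤u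

  ⋖⇒edge : ∀ {u v} → toℕ u ⋖ toℕ v → StarEdge ℓ u v
  ⋖⇒edge u⋖v = from-labels u⋖v refl refl
    where
    from-labels : ∀ {u v a b} → a ⋖ b → toℕ u ≡ a → toℕ v ≡ b → StarEdge ℓ u v
    from-labels 0⋖1 u≡0 v≡1 = inj₁ (u≡0 , v≡1)
    from-labels 0⋖2 u≡0 v≡2 = inj₂ (inj₁ (u≡0 , v≡2))
    from-labels 0⋖3 u≡0 v≡3 = inj₂ (inj₂ (inj₁ (u≡0 , v≡3)))
    from-labels (k⋖1+k 3≤k) refl v≡1+u = inj₂ (inj₂ (inj₂ (3≤k , v≡1+u)))

  adj⇒⋖ : ∀ {u v} → StarAdj ℓ u v → toℕ u ⋖ toℕ v ⊎ toℕ v ⋖ toℕ u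
  adj⇒⋖ (inj₁ uv) = inj₁ (edge⇒⋖ uv)
  adj⇒⋖ (inj₂ vu) = inj₂ (edge⇒⋖ vu)

  adj-sym : ∀ {u v} → StarAdj ℓ u v → StarAdj ℓ v u
  adj-sym (inj₁ uv) = inj₂ uv
  adj-sym (inj₂ vu) = inj₁ vu

  adj-irrefl : ∀ {u} → ¬ StarAdj ℓ u u
  adj-irrefl u~u with adj⇒⋖ u~u
  ... | inj₁ u⋖u = <-irrefl refl (⋖⇒< u⋖u)
  ... | inj₂ u⋖u = <-irrefl refl (⋖⇒< u⋖u)

  open Graph (StarAdj ℓ)
  open Game (StarAdj ℓ) adj-sym adj-irrefl

  parent-vertex : ∀ v → toℕ v ≢ 0 → Σ Vertex λ u → toℕ u ⋖ toℕ v
  parent-vertex v v≢0 with ⋖-parent v≢0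
  ... | a , a⋖v = fromℕ< a<3+ℓ , subst (_⋖ toℕ v) (sym (toℕ-fromℕ< a<3+ℓ)) a⋖v
    where
    a<3+ℓ : a < 3 + ℓ
    a<3+ℓ = ≤-trans (⋖⇒< a⋖v) (<⇒≤ (toℕ<n v))

  reach-from-centre : ∀ v → Reach (StarAdj ℓ) ⊤ centre v
  reach-from-centre = All.wfRec (Reach (StarAdj ℓ) ⊤ centre) towards
    where
    module All = WF.All (On.wellFounded toℕ <-wellFounded) _
    towards : ∀ v → (∀ {u} → toℕ u < toℕ v → Reach (StarAdj ℓ) ⊤ centre u) → Reach (StarAdj ℓ) ⊤ centre v
    towards v ih with toℕ v ≟ℕ 0
    ... | yes v≡0 = subst (Reach (StarAdj ℓ) ⊤ centre) (toℕ-injective {i = centre} (sym v≡0)) (here ∈⊤)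
    ... | no v≢0 with parent-vertex v v≢0
    ...   | u , u⋖v = step (ih (⋖⇒< u⋖v)) (inj₁ (⋖⇒edge u⋖v)) ∈⊤

  ⊤-connected : Connected ⊤
  ⊤-connected {u} {v} _ _ = reach-trans (reach-sym (reach-from-centre u)) (reach-from-centre v)

  neighbour-of-max-is-parent : ∀ {P m w} → UpperBound P m → w ∈ P → StarAdj ℓ w m →
                               toℕ w ⋖ toℕ m
  neighbour-of-max-is-parent max w∈P w~m with adj⇒⋖ w~m
  ... | inj₁ w⋖m = w⋖m
  ... | inj₂ m⋖w = ⊥-elim (<-irrefl refl (<-≤-trans (⋖⇒< m⋖w) (max w∈P)))

  max-is-leaf : ∀ {P m} → UpperBound P m → Leaf P m
  max-is-leaf max w∈P w′∈P w~m w′~m =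
    toℕ-injective (⋖-parent-unique (neighbour-of-max-is-parent max w∈P w~m)
                                   (neighbour-of-max-is-parent max w′∈P w′~m))

  leaf-exists : ∀ {P} → Connected P → Nonempty P → Σ Vertex λ m → m ∈ P × Leaf P m
  leaf-exists {P} _ nonempty with max-member P nonempty
  ... | m , m∈P , max = m , m∈P , max-is-leaf max

  -- Away from the centre a vertex has at most one child, so once that child is deleted only the
  -- parent remains as a neighbour.
  off-centre-leaf : ∀ {P m p} → toℕ p ⋖ toℕ m → toℕ p ≢ 0 → Leaf (P ∖ m) p
  off-centre-leaf {P} {m} {p} p⋖m p≢0 w∈ w′∈ w~p w′~p =
    toℕ-injective (⋖-parent-unique (parent w∈ w~p) (parent w′∈ w′~p))
    where
    parent : ∀ {w} → w ∈ P ∖ m → StarAdj ℓ w p → toℕ w ⋖ toℕ p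
    parent w∈ w~p with adj⇒⋖ w~p
    ... | inj₁ w⋖p = w⋖p
    ... | inj₂ p⋖w = ⊥-elim (x∈p∖y⇒x≢y w∈ (toℕ-injective (⋖-child-unique p⋖w p⋖m p≢0)))

  -- At the centre the only obstruction is P = K_{1,3}, whose 4 vertices are not 2 modulo 3.
  centre-leaf : ∀ {P m c} → ∣ P ∣ % 3 ≡ 2 → UpperBound P m → m ∈ P → c ∈ P →
                toℕ c ≡ 0 → 0 ⋖ toℕ m → Leaf (P ∖ m) c
  centre-leaf {P} {m} {c} ∣P∣%3≡2 max m∈P c∈P c≡0 0⋖m {w} {w′} w∈ w′∈ w~c w′~c
    with toℕ w ≟ℕ toℕ w′
  ... | yes w≡w′ = toℕ-injective w≡w′
  ... | no w≢w′ = contradiction (subst (λ s → s % 3 ≡ 2) ∣P∣≡4 ∣P∣%3≡2) λ ()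
    where
    child : ∀ {x} → StarAdj ℓ x c → 0 ⋖ toℕ x
    child {x} x~c with adj⇒⋖ x~c
    ... | inj₁ x⋖c = contradiction (subst (toℕ x <_) c≡0 (⋖⇒< x⋖c)) λ ()
    ... | inj₂ c⋖x = subst (_⋖ toℕ x) c≡0 c⋖x

    below-max : ∀ {x} → x ∈ P ∖ m → toℕ x < toℕ m
    below-max x∈ = ≤∧≢⇒< (max (p∖x⊆p x∈)) (λ x≡m → x∈p∖y⇒x≢y x∈ (toℕ-injective x≡m))

    claw : toℕ m ≡ 3 × (∀ {i} → i < 4 → i ≡ 0 ⊎ i ≡ toℕ w ⊎ i ≡ toℕ w′ ⊎ i ≡ toℕ m)
    claw = centre-claw (child w~c) (child w′~c) 0⋖m (below-max w∈) (below-max w′∈) w≢w′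

    onto : ∀ {i} → i < 4 → Σ Vertex λ x → x ∈ P × toℕ x ≡ i
    onto i<4 with proj₂ claw i<4
    ... | inj₁ i≡0 = c , c∈P , trans c≡0 (sym i≡0)
    ... | inj₂ (inj₁ i≡w) = w , p∖x⊆p w∈ , sym i≡w
    ... | inj₂ (inj₂ (inj₁ i≡w′)) = w′ , p∖x⊆p w′∈ , sym i≡w′
    ... | inj₂ (inj₂ (inj₂ i≡m)) = m , m∈P , sym i≡m

    ∣P∣≡4 : ∣ P ∣ ≡ 4
    ∣P∣≡4 = ∣p∣≡k-by-labels P 4 (λ {x} x∈P → s≤s (subst (toℕ x ≤_) (proj₁ claw) (max x∈P))) onto

  pendant-edge-exists : ∀ {P} → Connected P → ∣ P ∣ % 3 ≡ 2 → PendantEdge P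
  pendant-edge-exists {P} connected ∣P∣%3≡2
    with max-member P (∣p∣≢0⇒nonempty P (n%3≡2⇒n≢0 ∣P∣%3≡2))
  ... | m , m∈P , max with other-member m∈P (n%3≡2⇒n≢1 ∣P∣%3≡2)
  ... | u , u∈P , u≢m with reach-last-edge (connected u∈P m∈P) u≢m
  ... | s , s∈P , s~m = record
    { leaf = m ; stem = s ; leaf∈P = m∈P ; stem∈P = s∈P ; edge = adj-sym s~m
    ; leaf-is-leaf = max-is-leaf max ; stem-is-leaf = stem-is-leaf }
    where
    s⋖m : toℕ s ⋖ toℕ m
    s⋖m = neighbour-of-max-is-parent max s∈P s~m

    stem-is-leaf : Leaf (P ∖ m) s
    stem-is-leaf with toℕ s ≟ℕ 0
    ... | no s≢0 = off-centre-leaf s⋖m s≢0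
    ... | yes s≡0 = centre-leaf ∣P∣%3≡2 max m∈P s∈P s≡0 (subst (_⋖ toℕ m) s≡0 s⋖m)

  grundy-⊤ : IsGrundy (StarAdj ℓ) ⊤ (∣ ⊤ {3 + ℓ} ∣ % 3)
  grundy-⊤ = grundy≡size%3 leaf-exists pendant-edge-exists ⊤ ⊤-connected

lemma1 : (ℓ : ℕ) →
    IsGrundy (StarAdj ℓ) ⊤ (ℓ % 3) × ∣ ⊤ {3 + ℓ} ∣ % 3 ≡ ℓ % 3
lemma1 ℓ = subst (IsGrundy (StarAdj ℓ) ⊤) ∣V∣%3≡ℓ%3 (Star.grundy-⊤ ℓ) , ∣V∣%3≡ℓ%3
  where
  -- (3 + ℓ) % 3 reduces to ℓ % 3 definitionally.
  ∣V∣%3≡ℓ%3 : ∣ ⊤ {3 + ℓ} ∣ % 3 ≡ ℓ % 3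
  ∣V∣%3≡ℓ%3 = cong (_% 3) (∣⊤∣≡n (3 + ℓ))
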